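{- Let $n\ge 9$ and $3\le q\le \lceil n/2\rceil-2$ be integers, and put $r=\sum_{i=0}^{q}\binom{n}{i}$ and $s=\binom{q+\lfloor n/2\rfloor}{q}$. Then $r\ge 3s$. -}

module Defs where

open import Data.Nat using (ℕ; zero; suc; _+_)
open import Data.Nat.Combinatorics using (_C_)

binomSum : ℕ → ℕ → ℕ
binomSum n zero    = n C 0
binomSum n (suc q) = binomSum n q + n C (suc q)

-- Dropping all but the last two terms, binomSum n q ≥ C(n,q−1) + C(n,q) = C(n+1,q).
-- Write k = ⌊n/2⌋ and n + 1 = q + k + r, so r = ⌈n/2⌉ + 1 − q ≥ 3. Then
-- C(q+k+r,q) / C(q+k,q) = (q+k+r)! k! / ((q+k)! (k+r)!), and log-convexity of the
-- factorial bounds (q+k)! (k+r)! by (k+3)! (n−2)!, so the ratio is at least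
-- (n−1) n (n+1) / ((k+1)(k+2)(k+3)). Since 2k ≤ n this is ≥ 3 once n ≥ 11; for
-- n = 9, 10 the hypotheses force q = 3 and the inequality is checked directly.
module Submission where

open import Defs
open import Data.Nat using (ℕ; _≤_; _*_; _+_; ⌊_/2⌋; ⌈_/2⌉)
open import Data.Nat.Combinatorics using (_C_)

open import Data.Nat using (zero; suc; _∸_; _!; s≤s; NonZero)
open import Data.Nat.Properties
open import Algebra.Properties.CommutativeSemigroup *-commutativeSemigroup
  using (x∙yz≈y∙xz)
open import Data.Nat.DivMod using (m/n*n≡m)
open import Data.Nat.Combinatorics
  using (nCk+nC[k+1]≡[n+1]C[k+1]; k![n∸k]!∣n!)
open import Data.Nat.Combinatorics.Specification using (nCk≡n!/k![n-k]!)
open import Data.Nat.Tactic.RingSolver using (solve-∀)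
open import Data.Product using (_,_)
open import Data.Unit using (tt)
open import Relation.Binary.PropositionalEquality

nCk*k![n∸k]!≡n! : ∀ {n k} → k ≤ n → (n C k) * (k ! * (n ∸ k) !) ≡ n !
nCk*k![n∸k]!≡n! {n} {k} k≤n =
  trans (cong (_* (k ! * (n ∸ k) !)) (nCk≡n!/k![n-k]! k≤n))
        (m/n*n≡m {{k !* (n ∸ k) !≢0}} (k![n∸k]!∣n! k≤n))

[a+b]Ca*a!*b!≡[a+b]! : ∀ a b → ((a + b) C a) * (a ! * b !) ≡ (a + b) !
[a+b]Ca*a!*b!≡[a+b]! a b =
  subst (λ t → ((a + b) C a) * (a ! * t !) ≡ (a + b) !)
        (m+n∸m≡n a b) (nCk*k![n∸k]!≡n! (m≤m+n a b))

!-logConvex : ∀ a b x → (a + x) ! * (b + x) ! ≤ x ! * (a + b + x) !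
!-logConvex zero    b x = ≤-refl
!-logConvex (suc a) b x = begin
  (suc (a + x) * (a + x) !) * (b + x) !  ≡⟨ *-assoc (suc (a + x)) ((a + x) !) ((b + x) !) ⟩
  suc (a + x) * ((a + x) ! * (b + x) !)  ≤⟨ *-monoʳ-≤ (suc (a + x)) (!-logConvex a b x) ⟩
  suc (a + x) * (x ! * (a + b + x) !)
      ≤⟨ *-monoˡ-≤ (x ! * (a + b + x) !) (s≤s (+-monoˡ-≤ x (m≤m+n a b))) ⟩
  suc (a + b + x) * (x ! * (a + b + x) !) ≡⟨ x∙yz≈y∙xz (suc (a + b + x)) (x !) ((a + b + x) !) ⟩
  x ! * (suc (a + b + x) * (a + b + x) !) ∎
  where open ≤-Reasoning

C-ratio-bound : ∀ c q k r → c * ((q + k) ! * (k + r) !) ≤ (q + (k + r)) ! * k ! →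
                c * ((q + k) C q) ≤ (q + (k + r)) C q
C-ratio-bound c q k r hyp = *-cancelʳ-≤ _ _ D {{D≢0}} (begin
  (c * ((q + k) C q)) * D               ≡⟨ *-assoc c ((q + k) C q) D ⟩
  c * (((q + k) C q) * D)
      ≡⟨ cong (c *_) (sym (*-assoc ((q + k) C q) (q ! * k !) ((k + r) !))) ⟩
  c * ((((q + k) C q) * (q ! * k !)) * (k + r) !)
      ≡⟨ cong (λ t → c * (t * (k + r) !)) ([a+b]Ca*a!*b!≡[a+b]! q k) ⟩
  c * ((q + k) ! * (k + r) !)           ≤⟨ hyp ⟩
  (q + (k + r)) ! * k !
      ≡⟨ cong (_* k !) ([a+b]Ca*a!*b!≡[a+b]! q (k + r)) ⟨
  (((q + (k + r)) C q) * (q ! * (k + r) !)) * k !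
      ≡⟨ regroup ((q + (k + r)) C q) (q !) (k !) ((k + r) !) ⟩
  ((q + (k + r)) C q) * D ∎)
  where
  open ≤-Reasoning
  D = (q ! * k !) * (k + r) !
  D≢0 : NonZero D
  D≢0 = m*n≢0 _ _ {{q !* k !≢0}} {{(k + r) !≢0}}
  regroup : ∀ Y Q K R → (Y * (Q * R)) * K ≡ Y * ((Q * K) * R)
  regroup = solve-∀

rising₃ : ℕ → ℕ
rising₃ k = (3 + k) * ((2 + k) * (1 + k))

!-ratio-bound : ∀ c k z → c * rising₃ k ≤ rising₃ z → c * ((3 + k) ! * z !) ≤ (3 + z) ! * k !
!-ratio-bound c k z cubes = begin
  c * ((3 + k) ! * z !)       ≡⟨ split c k (k !) (z !) ⟩
  (c * rising₃ k) * (k ! * z !) ≤⟨ *-monoˡ-≤ (k ! * z !) cubes ⟩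
  rising₃ z * (k ! * z !)       ≡⟨ merge z (k !) (z !) ⟩
  (3 + z) ! * k !             ∎
  where
  open ≤-Reasoning
  split : ∀ c k K Z → c * ((3 + k) * ((2 + k) * ((1 + k) * K)) * Z) ≡
                      (c * ((3 + k) * ((2 + k) * (1 + k)))) * (K * Z)
  split = solve-∀
  merge : ∀ z K Z → ((3 + z) * ((2 + z) * (1 + z))) * (K * Z) ≡
                    ((3 + z) * ((2 + z) * ((1 + z) * Z))) * K
  merge = solve-∀

C-ratio-from-rising₃ : ∀ c k a b → c * rising₃ k ≤ rising₃ (a + b + (3 + k)) →
                       c * ((3 + a + k) C (3 + a)) ≤ (3 + (a + b + (3 + k))) C (3 + a)
C-ratio-from-rising₃ c k a b cubes =
  subst (λ m → c * ((3 + a + k) C (3 + a)) ≤ m C (3 + a)) (total a b k)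
        (C-ratio-bound c (3 + a) k (3 + b) factorials)
  where
  open ≤-Reasoning
  z = a + b + (3 + k)
  shift : ∀ a k → 3 + a + k ≡ a + (3 + k)
  shift = solve-∀
  total : ∀ a b k → 3 + a + (k + (3 + b)) ≡ 3 + (a + b + (3 + k))
  total = solve-∀
  factorials : c * ((3 + a + k) ! * (k + (3 + b)) !) ≤ (3 + a + (k + (3 + b))) ! * k !
  factorials = begin
    c * ((3 + a + k) ! * (k + (3 + b)) !)
      ≡⟨ cong₂ (λ u v → c * (u ! * v !)) (shift a k) (trans (+-comm k (3 + b)) (shift b k)) ⟩
    c * ((a + (3 + k)) ! * (b + (3 + k)) !) ≤⟨ *-monoʳ-≤ c (!-logConvex a b (3 + k)) ⟩
    c * ((3 + k) ! * z !)                 ≤⟨ !-ratio-bound c k z cubes ⟩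
    (3 + z) ! * k !                       ≡⟨ cong (λ m → m ! * k !) (total a b k) ⟨
    (3 + a + (k + (3 + b))) ! * k !       ∎

rising₃-cubic-bound : ∀ k z → 2 * k ≤ 2 + z → 9 ≤ z → 3 * rising₃ k ≤ rising₃ z
rising₃-cubic-bound k z 2k≤2+z 9≤z with m≤n⇒∃[o]m+o≡n 9≤z
... | t , refl = *-cancelˡ-≤ 8 (begin
  8 * (3 * rising₃ k)                               ≡⟨ doubled k ⟩
  3 * ((6 + 2 * k) * ((4 + 2 * k) * (2 + 2 * k)))
      ≤⟨ *-monoʳ-≤ 3 (*-mono-≤ (shifted 6) (*-mono-≤ (shifted 4) (shifted 2))) ⟩
  3 * ((8 + z) * ((6 + z) * (4 + z)))               ≤⟨ m≤m+n _ (slack t) ⟩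
  3 * ((8 + z) * ((6 + z) * (4 + z))) + slack t     ≡⟨ gap t ⟨
  8 * rising₃ z                                     ∎)
  where
  open ≤-Reasoning
  shifted : ∀ c → c + 2 * k ≤ c + (2 + z)
  shifted c = +-monoʳ-≤ c 2k≤2+z
  doubled : ∀ k → 8 * (3 * ((3 + k) * ((2 + k) * (1 + k)))) ≡
                  3 * ((6 + 2 * k) * ((4 + 2 * k) * (2 + 2 * k)))
  doubled = solve-∀
  -- 8 (z+1)(z+2)(z+3) − 3 (z+4)(z+6)(z+8) at z = 9 + t
  slack : ℕ → ℕ
  slack t = 615 + 883 * t + 129 * (t * t) + 5 * (t * t * t)
  gap : ∀ t → 8 * ((12 + t) * ((11 + t) * (10 + t))) ≡
              3 * ((17 + t) * ((15 + t) * (13 + t)))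
                + (615 + 883 * t + 129 * (t * t) + 5 * (t * t * t))
  gap = solve-∀

C≤binomSum : ∀ n p → n C p ≤ binomSum n p
C≤binomSum n zero    = ≤-refl
C≤binomSum n (suc p) = m≤n+m (n C suc p) (binomSum n p)

[1+n]C[1+p]≤binomSum : ∀ n p → suc n C suc p ≤ binomSum n (suc p)
[1+n]C[1+p]≤binomSum n p = subst (_≤ binomSum n (suc p)) (nCk+nC[k+1]≡[n+1]C[k+1] n p)
  (+-monoˡ-≤ (n C suc p) (C≤binomSum n p))

2*⌊n/2⌋≤n : ∀ n → 2 * ⌊ n /2⌋ ≤ n
2*⌊n/2⌋≤n n = begin
  2 * ⌊ n /2⌋           ≡⟨ cong (⌊ n /2⌋ +_) (+-identityʳ ⌊ n /2⌋) ⟩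
  ⌊ n /2⌋ + ⌊ n /2⌋     ≤⟨ +-monoʳ-≤ ⌊ n /2⌋ (⌊n/2⌋≤⌈n/2⌉ n) ⟩
  ⌊ n /2⌋ + ⌈ n /2⌉     ≡⟨ ⌊n/2⌋+⌈n/2⌉≡n n ⟩
  n                     ∎
  where open ≤-Reasoning

lemma4p5-11≤n : (n q : ℕ) → 11 ≤ n → 3 ≤ q → q + 2 ≤ ⌈ n /2⌉ →
                3 * ((q + ⌊ n /2⌋) C q) ≤ binomSum n q
lemma4p5-11≤n n q 11≤n 3≤q q+2≤⌈n/2⌉
  with m≤n⇒∃[o]m+o≡n 3≤q | m≤n⇒∃[o]m+o≡n q+2≤⌈n/2⌉
... | a , refl | b , q+2+b≡⌈n/2⌉ = begin
  3 * ((3 + a + k) C (3 + a))  ≤⟨ C-ratio-from-rising₃ 3 k a b (rising₃-cubic-bound k z 2k≤2+z 9≤z) ⟩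
  (3 + z) C (3 + a)            ≡⟨ cong (λ m → suc m C (3 + a)) 2+z≡n ⟩
  suc n C (3 + a)              ≤⟨ [1+n]C[1+p]≤binomSum n (2 + a) ⟩
  binomSum n (3 + a)           ∎
  where
  open ≤-Reasoning
  k = ⌊ n /2⌋
  z = a + b + (3 + k)
  regroup : ∀ a b k → 2 + (a + b + (3 + k)) ≡ k + (3 + a + 2 + b)
  regroup = solve-∀
  2+z≡n : 2 + z ≡ n
  2+z≡n = trans (regroup a b k) (trans (cong (k +_) q+2+b≡⌈n/2⌉) (⌊n/2⌋+⌈n/2⌉≡n n))
  2k≤2+z : 2 * k ≤ 2 + z
  2k≤2+z = subst (2 * k ≤_) (sym 2+z≡n) (2*⌊n/2⌋≤n n)
  9≤z : 9 ≤ z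
  9≤z = +-cancelˡ-≤ 2 9 z (subst (11 ≤_) (sym 2+z≡n) 11≤n)

lemma4p5 : (n q : ℕ) → 9 ≤ n → 3 ≤ q → q + 2 ≤ ⌈ n /2⌉ →
    3 * ((q + ⌊ n /2⌋) C q) ≤ binomSum n q
lemma4p5 n q 9≤n 3≤q q+2≤⌈n/2⌉ with m≤n⇒∃[o]m+o≡n 9≤n
... | 0 , refl rewrite ≤-antisym (+-cancelʳ-≤ 2 q 3 q+2≤⌈n/2⌉) 3≤q = ≤ᵇ⇒≤ _ _ tt
... | 1 , refl rewrite ≤-antisym (+-cancelʳ-≤ 2 q 3 q+2≤⌈n/2⌉) 3≤q = ≤ᵇ⇒≤ _ _ tt
... | suc (suc o) , refl = lemma4p5-11≤n n q (m≤m+n 11 o) 3≤q q+2≤⌈n/2⌉
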